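{- Let $a_{k,n}$ denote the entries of the binomial array $B(1-x)$, so $a_{k,n}=\binom{n}{k}-\binom{n}{k-1}$. For every integer $n\ge0$, $$C_{n+1}=-\sum_{i=0}^{n+1}a_{i,n}\,a_{n+1-i,n+1},$$ and for all $l\in\mathbb{Z}$, $$C_{n+1}=-\sum_{i=0}^{n+1}a_{i,n-l}\,a_{n+1-i,n+l+1},$$ where $C_j=\frac{1}{j+1}\binom{2j}{j}$ is the $j$-th Catalan number.
   Context: The binomial array $B(p(x))$ has entries $a_{k,n}$ ($k\ge0$, $n\in\mathbb{Z}$) equal to the coefficient of $x^k$ in $(1+x)^np(x)$, where for $n<0$, $(1+x)^n$ is the inverse power series. Binomial coefficients with negative upper index: $\binom{n}{k}=(-1)^k\binom{ -n+k-1}{k}$ for $n<0,k\ge0$; $\binom{n}{k}=0$ for $k<0$. -}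

module Defs where

open import Data.Nat using (ℕ; zero; suc; _∸_; _/_)
import Data.Nat as ℕ
open import Data.Nat.Combinatorics using (_C_)
open import Data.Integer using (ℤ; +_; -[1+_]; _+_; _-_; _*_; -_)

sign : ℕ → ℤ
sign zero = + 1
sign (suc k) = - sign k

-- generalized binomial coefficient  binom n k  for n ∈ ℤ, k ∈ ℕ:
--   n ≥ 0 : usual binomial coefficient
--   n < 0 : (-1)^k * C(-n+k-1, k);  with n = -[1+ m ] = -(m+1), -n+k-1 = m+k
binom : ℤ → ℕ → ℤ
binom (+ n) k = + (n C k)
binom -[1+ m ] k = sign k * + ((m ℕ.+ k) C k)

-- binomial coefficient with possibly negative lower index (zero for k < 0);
-- here only k-1 with k ∈ ℕ is needed
binomPred : ℤ → ℕ → ℤ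
binomPred n zero = + 0
binomPred n (suc k) = binom n k

a : ℕ → ℤ → ℤ
a k n = binom n k - binomPred n k

sumTo : ℕ → (ℕ → ℤ) → ℤ
sumTo zero f = f zero
sumTo (suc m) f = sumTo m f + f (suc m)

catalan : ℕ → ℕ
catalan j = ((2 ℕ.* j) C j) / suc j

-- Row p of B(1 − x) is the coefficient sequence of (1 + x)^p (1 − x), i.e. the backward
-- difference ∇ of the binomial row p. Sums of the shape Σ a_{i,p} a_{m−i,q} are coefficients
-- of products, so by Vandermonde's identity over ℤ (obtained from Pascal's rule one exponent
-- at a time, in both directions) the sum is the coefficient of x^(n+1) in
-- (1 + x)^(2n+1) (1 − x)^2, which only depends on p + q = 2n + 1. The symmetry of the row
-- 2n + 1 turns this into −(C(2n+1, n) − C(2n+1, n−1)), and this difference is C_{n+1} by the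
-- absorption identity k C(N, k) = (N − k + 1) C(N, k − 1).
module Submission where

open import Defs
open import Data.Nat using (ℕ; suc; _∸_)
open import Data.Integer using (ℤ; +_; _+_; _-_; _*_; -_)
open import Data.Product using (_×_)
open import Relation.Binary.PropositionalEquality using (_≡_)

open import Data.List using ([]; _∷_)
open import Data.Nat using (zero; _≤_)
import Data.Nat as ℕ
open import Data.Nat.Combinatorics
  using (_C_; nCk+nC[k+1]≡[n+1]C[k+1]; nCk≡nC[n∸k]; nC1≡n; nCn≡1)
open import Data.Nat.DivMod using (m*n/n≡m)
open import Data.Nat.Properties
  using (+-assoc; +-comm; +-suc; +-identityʳ; *-identityˡ; *-identityʳ; *-zeroʳ; *-comm;
         *-distribˡ-+; *-distribˡ-∸; +-cancelˡ-≡; *-cancelˡ-≤; +-∸-assoc; n∸n≡0; m+n∸m≡n;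
         m+n∸n≡m; m≤m+n; m≤n⇒m≤1+n; ≤-refl)
open import Data.Integer using (-[1+_]; _⊖_)
import Data.Integer.Properties as ℤ
open import Algebra.Properties.AbelianGroup ℤ.+-0-abelianGroup using (∙-cancelʳ)
import Data.Integer.Tactic.RingSolver as ℤ-Solver
import Data.Nat.Tactic.RingSolver as ℕ-Solver
open import Data.Product using (_,_)
open import Relation.Binary.PropositionalEquality
  using (refl; sym; trans; cong; cong₂; subst; module ≡-Reasoning)
open ≡-Reasoning

[k+1]*[n+1]C[k+1]≡[n+1]*nCk : ∀ n k → suc k ℕ.* (suc n C suc k) ≡ suc n ℕ.* (n C k)
[k+1]*[n+1]C[k+1]≡[n+1]*nCk n zero =
  trans (*-identityˡ _) (trans (nC1≡n (suc n)) (sym (*-identityʳ (suc n))))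
[k+1]*[n+1]C[k+1]≡[n+1]*nCk zero (suc k) = *-zeroʳ (suc (suc k))
[k+1]*[n+1]C[k+1]≡[n+1]*nCk (suc n) (suc k) = begin
    suc (suc k) ℕ.* (suc (suc n) C suc (suc k))
  ≡⟨ cong (suc (suc k) ℕ.*_) (nCk+nC[k+1]≡[n+1]C[k+1] (suc n) (suc k)) ⟨
    suc (suc k) ℕ.* (suc n C suc k ℕ.+ suc n C suc (suc k))
  ≡⟨ *-distribˡ-+ (suc (suc k)) (suc n C suc k) (suc n C suc (suc k)) ⟩
    suc n C suc k ℕ.+ suc k ℕ.* (suc n C suc k) ℕ.+ suc (suc k) ℕ.* (suc n C suc (suc k))
  ≡⟨ cong₂ (λ u v → suc n C suc k ℕ.+ u ℕ.+ v)
       ([k+1]*[n+1]C[k+1]≡[n+1]*nCk n k) ([k+1]*[n+1]C[k+1]≡[n+1]*nCk n (suc k)) ⟩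
    suc n C suc k ℕ.+ suc n ℕ.* (n C k) ℕ.+ suc n ℕ.* (n C suc k)
  ≡⟨ +-assoc (suc n C suc k) _ _ ⟩
    suc n C suc k ℕ.+ (suc n ℕ.* (n C k) ℕ.+ suc n ℕ.* (n C suc k))
  ≡⟨ cong (suc n C suc k ℕ.+_) (*-distribˡ-+ (suc n) (n C k) (n C suc k)) ⟨
    suc n C suc k ℕ.+ suc n ℕ.* (n C k ℕ.+ n C suc k)
  ≡⟨ cong (λ u → suc n C suc k ℕ.+ suc n ℕ.* u) (nCk+nC[k+1]≡[n+1]C[k+1] n k) ⟩
    suc (suc n) ℕ.* (suc n C suc k) ∎

[k+1]*nCk+[k+1]*nC[k+1]≡[n+1]*nCk : ∀ n k →
  suc k ℕ.* (n C k) ℕ.+ suc k ℕ.* (n C suc k) ≡ suc n ℕ.* (n C k)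
[k+1]*nCk+[k+1]*nC[k+1]≡[n+1]*nCk n k = begin
    suc k ℕ.* (n C k) ℕ.+ suc k ℕ.* (n C suc k)
  ≡⟨ *-distribˡ-+ (suc k) (n C k) (n C suc k) ⟨
    suc k ℕ.* (n C k ℕ.+ n C suc k)
  ≡⟨ cong (suc k ℕ.*_) (nCk+nC[k+1]≡[n+1]C[k+1] n k) ⟩
    suc k ℕ.* (suc n C suc k)
  ≡⟨ [k+1]*[n+1]C[k+1]≡[n+1]*nCk n k ⟩
    suc n ℕ.* (n C k) ∎

[2n+1]C[n+1]≡[2n+1]Cn : ∀ n → suc (n ℕ.+ n) C suc n ≡ suc (n ℕ.+ n) C n
[2n+1]C[n+1]≡[2n+1]Cn n = sym (begin
    suc (n ℕ.+ n) C n
  ≡⟨ nCk≡nC[n∸k] (m≤n⇒m≤1+n (m≤m+n n n)) ⟩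
    suc (n ℕ.+ n) C (suc n ℕ.+ n ∸ n)
  ≡⟨ cong (suc (n ℕ.+ n) C_) (m+n∸n≡m (suc n) n) ⟩
    suc (n ℕ.+ n) C suc n ∎)

[2n+2]C[n+1]≡2*[2n+1]Cn : ∀ n →
  (2 ℕ.* suc n) C suc n ≡ suc (n ℕ.+ n) C n ℕ.+ suc (n ℕ.+ n) C n
[2n+2]C[n+1]≡2*[2n+1]Cn n = begin
    (2 ℕ.* suc n) C suc n
  ≡⟨ cong (_C suc n) (double-suc n) ⟩
    suc (suc (n ℕ.+ n)) C suc n
  ≡⟨ nCk+nC[k+1]≡[n+1]C[k+1] (suc (n ℕ.+ n)) n ⟨
    suc (n ℕ.+ n) C n ℕ.+ suc (n ℕ.+ n) C suc n
  ≡⟨ cong (suc (n ℕ.+ n) C n ℕ.+_) ([2n+1]C[n+1]≡[2n+1]Cn n) ⟩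
    suc (n ℕ.+ n) C n ℕ.+ suc (n ℕ.+ n) C n ∎
  where
  double-suc : ∀ n → 2 ℕ.* suc n ≡ suc (suc (n ℕ.+ n))
  double-suc = ℕ-Solver.solve-∀

module _ (k : ℕ) where
  private
    N Y Z k+3 : ℕ
    N = suc (suc k ℕ.+ suc k)
    Y = N C suc k
    Z = N C k
    k+3 = suc (suc (suc k))

    cross-multiplied : ∀ j y z →
      suc j ℕ.* z ℕ.+ suc j ℕ.* y ≡ suc (suc (suc j ℕ.+ suc j)) ℕ.* z →
      suc (suc (suc j)) ℕ.* y ≡ suc (suc (suc j)) ℕ.* z ℕ.+ (y ℕ.+ y)
    cross-multiplied j y z ratio = +-cancelˡ-≡ (suc j ℕ.* z) _ _ (begin
        suc j ℕ.* z ℕ.+ suc (suc (suc j)) ℕ.* y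
      ≡⟨ ℕ-Solver.solve (j ∷ y ∷ z ∷ []) ⟩
        suc j ℕ.* z ℕ.+ suc j ℕ.* y ℕ.+ (y ℕ.+ y)
      ≡⟨ cong (ℕ._+ (y ℕ.+ y)) ratio ⟩
        suc (suc (suc j ℕ.+ suc j)) ℕ.* z ℕ.+ (y ℕ.+ y)
      ≡⟨ ℕ-Solver.solve (j ∷ y ∷ z ∷ []) ⟩
        suc j ℕ.* z ℕ.+ (suc (suc (suc j)) ℕ.* z ℕ.+ (y ℕ.+ y)) ∎)

    [k+3]*Y≡[k+3]*Z+2*Y : k+3 ℕ.* Y ≡ k+3 ℕ.* Z ℕ.+ (Y ℕ.+ Y)
    [k+3]*Y≡[k+3]*Z+2*Y = cross-multiplied k Y Z ([k+1]*nCk+[k+1]*nC[k+1]≡[n+1]*nCk N k)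

    Z≤Y : Z ≤ Y
    Z≤Y = *-cancelˡ-≤ k+3
      (subst (k+3 ℕ.* Z ≤_) (sym [k+3]*Y≡[k+3]*Z+2*Y) (m≤m+n (k+3 ℕ.* Z) (Y ℕ.+ Y)))

    [Y∸Z]*[k+3]≡2*Y : (Y ∸ Z) ℕ.* k+3 ≡ Y ℕ.+ Y
    [Y∸Z]*[k+3]≡2*Y = begin
        (Y ∸ Z) ℕ.* k+3
      ≡⟨ *-comm (Y ∸ Z) k+3 ⟩
        k+3 ℕ.* (Y ∸ Z)
      ≡⟨ *-distribˡ-∸ k+3 Y Z ⟩
        k+3 ℕ.* Y ∸ k+3 ℕ.* Z
      ≡⟨ cong (ℕ._∸ k+3 ℕ.* Z) [k+3]*Y≡[k+3]*Z+2*Y ⟩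
        k+3 ℕ.* Z ℕ.+ (Y ℕ.+ Y) ∸ k+3 ℕ.* Z
      ≡⟨ m+n∸m≡n (k+3 ℕ.* Z) (Y ℕ.+ Y) ⟩
        Y ℕ.+ Y ∎

  catalan[k+2]≡[2k+3]C[k+1]∸[2k+3]Ck : catalan (suc (suc k)) ≡ Y ∸ Z
  catalan[k+2]≡[2k+3]C[k+1]∸[2k+3]Ck = begin
      catalan (suc (suc k))
    ≡⟨ cong (ℕ._/ k+3) ([2n+2]C[n+1]≡2*[2n+1]Cn (suc k)) ⟩
      (Y ℕ.+ Y) ℕ./ k+3
    ≡⟨ cong (ℕ._/ k+3) [Y∸Z]*[k+3]≡2*Y ⟨
      (Y ∸ Z) ℕ.* k+3 ℕ./ k+3
    ≡⟨ m*n/n≡m (Y ∸ Z) k+3 ⟩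
      Y ∸ Z ∎

  catalan[k+2]≡a[k+1][2k+3] : + catalan (suc (suc k)) ≡ a (suc k) (+ N)
  catalan[k+2]≡a[k+1][2k+3] = begin
      + catalan (suc (suc k))
    ≡⟨ cong +_ catalan[k+2]≡[2k+3]C[k+1]∸[2k+3]Ck ⟩
      + (Y ∸ Z)
    ≡⟨ ℤ.⊖-≥ Z≤Y ⟨
      Y ⊖ Z
    ≡⟨ ℤ.[+m]-[+n]≡m⊖n Y Z ⟨
      + Y - + Z ∎

catalan[n+1]≡a[n][2n+1] : ∀ n → + catalan (suc n) ≡ a n (+ suc (n ℕ.+ n))
catalan[n+1]≡a[n][2n+1] zero = refl
catalan[n+1]≡a[n][2n+1] (suc k) = catalan[k+2]≡a[k+1][2k+3] k

-- Power series as coefficient sequences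

-- f ⋆ g, shift f and ∇ f are the coefficients of F G, x F and (1 − x) F.
infixl 7 _⋆_

_⋆_ : (ℕ → ℤ) → (ℕ → ℤ) → ℕ → ℤ
(f ⋆ g) m = sumTo m (λ i → f i * g (m ∸ i))

shift : (ℕ → ℤ) → ℕ → ℤ
shift f zero = + 0
shift f (suc k) = f k

∇ : (ℕ → ℤ) → ℕ → ℤ
∇ f k = f k - shift f k

sumTo-cong : ∀ m {F G : ℕ → ℤ} → (∀ i → i ≤ m → F i ≡ G i) → sumTo m F ≡ sumTo m G
sumTo-cong zero eq = eq zero ℕ.z≤n
sumTo-cong (suc m) eq =
  cong₂ _+_ (sumTo-cong m (λ i i≤m → eq i (m≤n⇒m≤1+n i≤m))) (eq (suc m) ≤-refl)

sumTo-zero : ∀ m → sumTo m (λ _ → + 0) ≡ + 0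
sumTo-zero zero = refl
sumTo-zero (suc m) = cong (_+ + 0) (sumTo-zero m)

sumTo-suc : ∀ m F → sumTo (suc m) F ≡ F 0 + sumTo m (λ i → F (suc i))
sumTo-suc zero F = refl
sumTo-suc (suc m) F =
  trans (cong (_+ F (suc (suc m))) (sumTo-suc m F)) (ℤ.+-assoc (F 0) _ _)

sumTo-+ : ∀ m F G → sumTo m (λ i → F i + G i) ≡ sumTo m F + sumTo m G
sumTo-+ zero F G = refl
sumTo-+ (suc m) F G =
  trans (cong (_+ (F (suc m) + G (suc m))) (sumTo-+ m F G))
        (interchange (sumTo m F) (sumTo m G) (F (suc m)) (G (suc m)))
  where
  interchange : ∀ w x y z → w + x + (y + z) ≡ w + y + (x + z)
  interchange = ℤ-Solver.solve-∀

sumTo-- : ∀ m F G → sumTo m (λ i → F i - G i) ≡ sumTo m F - sumTo m G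
sumTo-- zero F G = refl
sumTo-- (suc m) F G =
  trans (cong (_+ (F (suc m) - G (suc m))) (sumTo-- m F G))
        (interchange (sumTo m F) (sumTo m G) (F (suc m)) (G (suc m)))
  where
  interchange : ∀ w x y z → w - x + (y - z) ≡ w + y - (x + z)
  interchange = ℤ-Solver.solve-∀

shift-cong : ∀ {f g} → (∀ k → f k ≡ g k) → ∀ k → shift f k ≡ shift g k
shift-cong eq zero = refl
shift-cong eq (suc k) = eq k

∇-cong : ∀ {f g} → (∀ k → f k ≡ g k) → ∀ k → ∇ f k ≡ ∇ g k
∇-cong eq k = cong₂ _-_ (eq k) (shift-cong eq k)

⋆-cong : ∀ {f f′ g g′} → (∀ i → f i ≡ f′ i) → (∀ j → g j ≡ g′ j) →
  ∀ m → (f ⋆ g) m ≡ (f′ ⋆ g′) m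
⋆-cong eqf eqg m = sumTo-cong m (λ i _ → cong₂ _*_ (eqf i) (eqg (m ∸ i)))

⋆-distribˡ-+ : ∀ f g h m → (f ⋆ (λ j → g j + h j)) m ≡ (f ⋆ g) m + (f ⋆ h) m
⋆-distribˡ-+ f g h m =
  trans (sumTo-cong m (λ i _ → ℤ.*-distribˡ-+ (f i) _ _)) (sumTo-+ m _ _)

⋆-distribˡ-- : ∀ f g h m → (f ⋆ (λ j → g j - h j)) m ≡ (f ⋆ g) m - (f ⋆ h) m
⋆-distribˡ-- f g h m = trans (sumTo-cong m (λ i _ → distrib (f i) _ _)) (sumTo-- m _ _)
  where
  distrib : ∀ x y z → x * (y - z) ≡ x * y - x * z
  distrib = ℤ-Solver.solve-∀

⋆-distribʳ-- : ∀ f g h m → ((λ i → f i - g i) ⋆ h) m ≡ (f ⋆ h) m - (g ⋆ h) m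
⋆-distribʳ-- f g h m = trans (sumTo-cong m (λ i _ → distrib (f i) (g i) (h (m ∸ i)))) (sumTo-- m _ _)
  where
  distrib : ∀ x y z → (x - y) * z ≡ x * z - y * z
  distrib = ℤ-Solver.solve-∀

⋆-shiftʳ : ∀ f g m → (f ⋆ shift g) m ≡ shift (f ⋆ g) m
⋆-shiftʳ f g zero = ℤ.*-zeroʳ (f 0)
⋆-shiftʳ f g (suc k) = begin
    sumTo k (λ i → f i * shift g (suc k ∸ i)) + f (suc k) * shift g (k ∸ k)
  ≡⟨ cong₂ _+_ (sumTo-cong k (λ i i≤k → cong (λ j → f i * shift g j) (+-∸-assoc 1 i≤k)))
               (cong (λ j → f (suc k) * shift g j) (n∸n≡0 k)) ⟩
    (f ⋆ g) k + f (suc k) * + 0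
  ≡⟨ cong (_+_ ((f ⋆ g) k)) (ℤ.*-zeroʳ (f (suc k))) ⟩
    (f ⋆ g) k + + 0
  ≡⟨ ℤ.+-identityʳ _ ⟩
    (f ⋆ g) k ∎

⋆-shiftˡ : ∀ f g m → (shift f ⋆ g) m ≡ shift (f ⋆ g) m
⋆-shiftˡ f g zero = ℤ.*-zeroˡ (g 0)
⋆-shiftˡ f g (suc k) = begin
    (shift f ⋆ g) (suc k)
  ≡⟨ sumTo-suc k (λ i → shift f i * g (suc k ∸ i)) ⟩
    + 0 * g (suc k) + (f ⋆ g) k
  ≡⟨ cong (_+ (f ⋆ g) k) (ℤ.*-zeroˡ (g (suc k))) ⟩
    + 0 + (f ⋆ g) k
  ≡⟨ ℤ.+-identityˡ _ ⟩
    (f ⋆ g) k ∎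

⋆-∇ʳ : ∀ f g m → (f ⋆ ∇ g) m ≡ ∇ (f ⋆ g) m
⋆-∇ʳ f g m =
  trans (⋆-distribˡ-- f g (shift g) m) (cong (_-_ ((f ⋆ g) m)) (⋆-shiftʳ f g m))

⋆-∇ˡ : ∀ f g m → (∇ f ⋆ g) m ≡ ∇ (f ⋆ g) m
⋆-∇ˡ f g m =
  trans (⋆-distribʳ-- f (shift f) g m) (cong (_-_ ((f ⋆ g) m)) (⋆-shiftˡ f g m))

∇⋆∇ : ∀ f g m → (∇ f ⋆ ∇ g) m ≡ ∇ (∇ (f ⋆ g)) m
∇⋆∇ f g m = trans (⋆-∇ˡ f (∇ g) m) (∇-cong (⋆-∇ʳ f g) m)

-- Binomial coefficients with integer upper index

-- Pascal's rule for the magnitudes of a negative row, transported through sign (suc k) = - sign k.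
sign-pascal : ∀ k {x y z} → x ℕ.+ y ≡ z →
  sign (suc k) * + y ≡ sign (suc k) * + z + sign k * + x
sign-pascal k {x} {y} refl = trans (rearrange (sign k) (+ x) (+ y))
  (cong (λ t → - sign k * t + sign k * + x) (sym (ℤ.pos-+ x y)))
  where
  rearrange : ∀ s u v → - s * v ≡ - s * (u + v) + s * u
  rearrange = ℤ-Solver.solve-∀

binom-pascal : ∀ p k → binom (p + + 1) k ≡ binom p k + shift (binom p) k
binom-pascal (+ n) zero = refl
binom-pascal (+ n) (suc k) = begin
    + ((n ℕ.+ 1) C suc k)
  ≡⟨ cong (λ m → + (m C suc k)) (+-comm n 1) ⟩
    + (suc n C suc k)
  ≡⟨ cong +_ (nCk+nC[k+1]≡[n+1]C[k+1] n k) ⟨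
    + (n C k ℕ.+ n C suc k)
  ≡⟨ ℤ.pos-+ (n C k) (n C suc k) ⟩
    + (n C k) + + (n C suc k)
  ≡⟨ ℤ.+-comm (+ (n C k)) (+ (n C suc k)) ⟩
    + (n C suc k) + + (n C k) ∎
binom-pascal -[1+ zero ] zero = refl
binom-pascal -[1+ zero ] (suc k) =
  trans (sym (ℤ.*-zeroʳ (sign (suc k))))
        (sign-pascal k (trans (+-identityʳ (k C k)) (trans (nCn≡1 k) (sym (nCn≡1 (suc k))))))
binom-pascal -[1+ suc m ] zero = refl
binom-pascal -[1+ suc m ] (suc k) = sign-pascal k (begin
    suc (m ℕ.+ k) C k ℕ.+ (m ℕ.+ suc k) C suc k
  ≡⟨ cong (λ t → suc (m ℕ.+ k) C k ℕ.+ t C suc k) (+-suc m k) ⟩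
    suc (m ℕ.+ k) C k ℕ.+ suc (m ℕ.+ k) C suc k
  ≡⟨ nCk+nC[k+1]≡[n+1]C[k+1] (suc (m ℕ.+ k)) k ⟩
    suc (suc (m ℕ.+ k)) C suc k
  ≡⟨ cong (λ t → suc t C suc k) (+-suc m k) ⟨
    suc (m ℕ.+ suc k) C suc k ∎)

⋆-binom-identityʳ : ∀ f m → (f ⋆ binom (+ 0)) m ≡ f m
⋆-binom-identityʳ f zero = ℤ.*-identityʳ (f 0)
⋆-binom-identityʳ f (suc k) = begin
    sumTo k (λ i → f i * binom (+ 0) (suc k ∸ i)) + f (suc k) * binom (+ 0) (k ∸ k)
  ≡⟨ cong₂ _+_ (sumTo-cong k vanishing) (cong (λ j → f (suc k) * binom (+ 0) j) (n∸n≡0 k)) ⟩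
    sumTo k (λ _ → + 0) + f (suc k) * + 1
  ≡⟨ cong₂ _+_ (sumTo-zero k) (ℤ.*-identityʳ (f (suc k))) ⟩
    + 0 + f (suc k)
  ≡⟨ ℤ.+-identityˡ _ ⟩
    f (suc k) ∎
  where
  vanishing : ∀ i → i ≤ k → f i * binom (+ 0) (suc k ∸ i) ≡ + 0
  vanishing i i≤k =
    trans (cong (λ j → f i * binom (+ 0) j) (+-∸-assoc 1 i≤k)) (ℤ.*-zeroʳ (f i))

⋆-binom-suc : ∀ f q m → (f ⋆ binom (q + + 1)) m ≡ (f ⋆ binom q) m + shift (f ⋆ binom q) m
⋆-binom-suc f q m = begin
    (f ⋆ binom (q + + 1)) m
  ≡⟨ ⋆-cong {f} (λ _ → refl) (binom-pascal q) m ⟩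
    (f ⋆ (λ j → binom q j + shift (binom q) j)) m
  ≡⟨ ⋆-distribˡ-+ f (binom q) (shift (binom q)) m ⟩
    (f ⋆ binom q) m + (f ⋆ shift (binom q)) m
  ≡⟨ cong (_+_ ((f ⋆ binom q) m)) (⋆-shiftʳ f (binom q) m) ⟩
    (f ⋆ binom q) m + shift (f ⋆ binom q) m ∎

Vandermonde : ℤ → ℤ → Set
Vandermonde p q = ∀ m → (binom p ⋆ binom q) m ≡ binom (p + q) m

vandermonde-suc : ∀ p q → Vandermonde p q → Vandermonde p (q + + 1)
vandermonde-suc p q hyp m = begin
    (binom p ⋆ binom (q + + 1)) m
  ≡⟨ ⋆-binom-suc (binom p) q m ⟩
    (binom p ⋆ binom q) m + shift (binom p ⋆ binom q) m
  ≡⟨ cong₂ _+_ (hyp m) (shift-cong hyp m) ⟩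
    binom (p + q) m + shift (binom (p + q)) m
  ≡⟨ binom-pascal (p + q) m ⟨
    binom (p + q + + 1) m
  ≡⟨ cong (λ r → binom r m) (ℤ.+-assoc p q (+ 1)) ⟩
    binom (p + (q + + 1)) m ∎

vandermonde-pred : ∀ p q → Vandermonde p (q + + 1) → Vandermonde p q
vandermonde-pred p q hyp m = ∙-cancelʳ (shift (binom (p + q)) m) _ _ (begin
    (binom p ⋆ binom q) m + shift (binom (p + q)) m
  ≡⟨ cong (_+_ ((binom p ⋆ binom q) m)) (lower m) ⟨
    (binom p ⋆ binom q) m + shift (binom p ⋆ binom q) m
  ≡⟨ ⋆-binom-suc (binom p) q m ⟨
    (binom p ⋆ binom (q + + 1)) m
  ≡⟨ hyp m ⟩
    binom (p + (q + + 1)) m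
  ≡⟨ cong (λ r → binom r m) (ℤ.+-assoc p q (+ 1)) ⟨
    binom (p + q + + 1) m
  ≡⟨ binom-pascal (p + q) m ⟩
    binom (p + q) m + shift (binom (p + q)) m ∎)
  where
  lower : ∀ m → shift (binom p ⋆ binom q) m ≡ shift (binom (p + q)) m
  lower zero = refl
  lower (suc k) = vandermonde-pred p q hyp k

vandermonde-+ : ∀ p n → Vandermonde p (+ n)
vandermonde-+ p zero m =
  trans (⋆-binom-identityʳ (binom p) m) (cong (λ r → binom r m) (sym (ℤ.+-identityʳ p)))
vandermonde-+ p (suc n) =
  subst (Vandermonde p) (cong +_ (+-comm n 1)) (vandermonde-suc p (+ n) (vandermonde-+ p n))

vandermonde : ∀ p q → Vandermonde p q
vandermonde p (+ n) = vandermonde-+ p n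
vandermonde p -[1+ zero ] = vandermonde-pred p -[1+ zero ] (vandermonde-+ p zero)
vandermonde p -[1+ suc n ] = vandermonde-pred p -[1+ suc n ] (vandermonde p -[1+ n ])

a≡∇binom : ∀ k p → a k p ≡ ∇ (binom p) k
a≡∇binom zero p = refl
a≡∇binom (suc k) p = refl

sum-a*a≡∇∇binom : ∀ p q m → sumTo m (λ i → a i p * a (m ∸ i) q) ≡ ∇ (∇ (binom (p + q))) m
sum-a*a≡∇∇binom p q m = begin
    sumTo m (λ i → a i p * a (m ∸ i) q)
  ≡⟨ ⋆-cong (λ i → a≡∇binom i p) (λ j → a≡∇binom j q) m ⟩
    (∇ (binom p) ⋆ ∇ (binom q)) m
  ≡⟨ ∇⋆∇ (binom p) (binom q) m ⟩
    ∇ (∇ (binom p ⋆ binom q)) m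
  ≡⟨ ∇-cong (∇-cong (vandermonde p q)) m ⟩
    ∇ (∇ (binom (p + q))) m ∎

catalan[n+1]≡-∇∇binom[2n+1] : ∀ n →
  + catalan (suc n) ≡ - ∇ (∇ (binom (+ suc (n ℕ.+ n)))) (suc n)
catalan[n+1]≡-∇∇binom[2n+1] n = begin
    + catalan (suc n)
  ≡⟨ catalan[n+1]≡a[n][2n+1] n ⟩
    a n (+ N)
  ≡⟨ a≡∇binom n (+ N) ⟩
    ∇ (binom (+ N)) n
  ≡⟨ cancel (∇ (binom (+ N)) n) (+ (N C n)) ⟩
    - ((+ (N C n) - + (N C n)) - ∇ (binom (+ N)) n)
  ≡⟨ cong (λ t → - ((+ t - + (N C n)) - ∇ (binom (+ N)) n)) ([2n+1]C[n+1]≡[2n+1]Cn n) ⟨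
    - ∇ (∇ (binom (+ N))) (suc n) ∎
  where
  N = suc (n ℕ.+ n)
  cancel : ∀ x y → x ≡ - ((y - y) - x)
  cancel = ℤ-Solver.solve-∀

catalan-sum : ∀ n p q → p + q ≡ + suc (n ℕ.+ n) →
  + catalan (suc n) ≡ - sumTo (suc n) (λ i → a i p * a (suc n ∸ i) q)
catalan-sum n p q p+q≡2n+1 = begin
    + catalan (suc n)
  ≡⟨ catalan[n+1]≡-∇∇binom[2n+1] n ⟩
    - ∇ (∇ (binom (+ suc (n ℕ.+ n)))) (suc n)
  ≡⟨ cong (λ s → - ∇ (∇ (binom s)) (suc n)) p+q≡2n+1 ⟨
    - ∇ (∇ (binom (p + q))) (suc n)
  ≡⟨ cong -_ (sum-a*a≡∇∇binom p q (suc n)) ⟨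
    - sumTo (suc n) (λ i → a i p * a (suc n ∸ i) q) ∎

corollary8p5 : (n : ℕ) →
    ((+ catalan (suc n)) ≡ - sumTo (suc n) (λ i → a i (+ n) * a (suc n ∸ i) (+ suc n)))
    × ((l : ℤ) →
      (+ catalan (suc n)) ≡ - sumTo (suc n) (λ i → a i (+ n - l) * a (suc n ∸ i) (+ n + l + + 1)))
corollary8p5 n =
    catalan-sum n (+ n) (+ suc n) (cong +_ (+-suc n n))
  , λ l → catalan-sum n (+ n - l) (+ n + l + + 1)
            (trans (exponents-sum (+ n) l) (cong +_ (+-comm (n ℕ.+ n) 1)))
  where
  exponents-sum : ∀ x l → x - l + (x + l + + 1) ≡ x + x + + 1
  exponents-sum = ℤ-Solver.solve-∀
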